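{- Let $\ell\ge 2$ be an integer and let $M$ be a simple binary matroid with set of circuits $\mathcal C$. The following are equivalent: (1) $M$ is $\ell$-closed; (2) $M$ is $(\ell+2)$-chordal; (3) $\mathcal C=\mathrm{cl}_\Delta(\mathcal C_{\ell+1})$, where $\mathcal C_{\ell+1}=\{C\in\mathcal C: |C|\le \ell+1\}$.
   Context: Matroids are finite on ground set $[n]$; simple means all circuits have at least three elements; binary means the symmetric difference of any two different circuits is a union of disjoint circuits. $\mathrm{cl}$ denotes matroid closure. A circuit $C$ has a chord $i_0$ (and $i_0$ splits $C$ into $C_1,C_2$) if there are circuits $C_1,C_2$ with $C_1\cap C_2=\{i_0\}$ and $C=C_1\Delta C_2$. $M$ is $k$-chordal if every circuit with at least $k$ elements has a chord. $M$ is $\ell$-closed if for every $X\subseteq[n]$: $X$ is closed iff for every $Y\subseteq X$ with $|Y|\le\ell$ one has $\mathrm{cl}(Y)\subseteq X$. For $\mathcal C'\subseteq\mathcal C$, $\mathrm{cl}_\Delta(\mathcal C')$ is the smallest subset of $\mathcal C$ that contains $\mathcal C'$ and has the property that whenever a circuit $C$ splits into two circuits $C_1,C_2$ both belonging to it, then $C$ also belongs to it. -}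

module Defs where

open import Data.Nat using (ℕ; _≤_; _+_)
open import Data.Fin using (Fin)
open import Data.Fin.Subset
  using (Subset; ⊥; ⁅_⁆; _∈_; _∉_; _⊆_; _∩_; _∪_; _─_; _-_; ∣_∣)
open import Data.List using (List; foldr)
open import Data.List.Relation.Unary.All using (All)
open import Data.List.Relation.Unary.AllPairs using (AllPairs)
open import Data.Product using (Σ; ∃; _×_)
open import Data.Sum using (_⊎_)
open import Relation.Nullary using (¬_)
open import Relation.Unary using (Decidable)
open import Relation.Binary.PropositionalEquality using (_≡_; _≢_)
open import Function.Bundles using (_⇔_)

_Δ_ : ∀ {n} → Subset n → Subset n → Subset n
A Δ B = (A ─ B) ∪ (B ─ A)

record Matroid (n : ℕ) : Set₁ where
  field
    IsCircuit   : Subset n → Set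
    circuit?    : Decidable IsCircuit
    empty-not   : ¬ IsCircuit ⊥
    incomparable : ∀ {C D} → IsCircuit C → IsCircuit D → C ⊆ D → C ≡ D
    elimination : ∀ {C D e} → IsCircuit C → IsCircuit D → C ≢ D →
                  e ∈ C → e ∈ D →
                  ∃ λ E → IsCircuit E × E ⊆ ((C ∪ D) - e)

module _ {n : ℕ} (M : Matroid n) where
  open Matroid M

  Simple : Set
  Simple = ∀ C → IsCircuit C → 3 ≤ ∣ C ∣

  ⋃ : List (Subset n) → Subset n
  ⋃ = foldr _∪_ ⊥

  Disjoint : Subset n → Subset n → Set
  Disjoint A B = A ∩ B ≡ ⊥

  Binary : Set
  Binary = ∀ C D → IsCircuit C → IsCircuit D → C ≢ D →
           ∃ λ (Cs : List (Subset n)) →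
             All IsCircuit Cs × AllPairs Disjoint Cs × ⋃ Cs ≡ (C Δ D)

  _∈cl_ : Fin n → Subset n → Set
  e ∈cl X = e ∈ X ⊎ (∃ λ C → IsCircuit C × e ∈ C × ((C - e) ⊆ X))

  ClSub : Subset n → Subset n → Set
  ClSub Y X = ∀ e → e ∈cl Y → e ∈ X

  Closed : Subset n → Set
  Closed X = ClSub X X

  IsClosedBy : ℕ → Set
  IsClosedBy ℓ = ∀ X → Closed X ⇔ (∀ Y → Y ⊆ X → ∣ Y ∣ ≤ ℓ → ClSub Y X)

  SplitsInto : Subset n → Fin n → Subset n → Subset n → Set
  SplitsInto C i₀ C₁ C₂ =
    IsCircuit C₁ × IsCircuit C₂ × (C₁ ∩ C₂ ≡ ⁅ i₀ ⁆) × (C ≡ C₁ Δ C₂)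

  HasChordAt : Subset n → Fin n → Set
  HasChordAt C i₀ = ∃ λ C₁ → ∃ λ C₂ → SplitsInto C i₀ C₁ C₂

  Chordal : ℕ → Set
  Chordal k = ∀ C → IsCircuit C → k ≤ ∣ C ∣ → ∃ λ i₀ → HasChordAt C i₀

  -- cl_Δ(𝒞') for 𝒞' ⊆ 𝒞 (given as a predicate on circuits): the smallest
  -- family of circuits containing 𝒞' and closed under splitting,
  -- presented as an inductively generated predicate.
  data ClΔ (𝒞' : Subset n → Set) : Subset n → Set where
    base  : ∀ {C} → IsCircuit C → 𝒞' C → ClΔ 𝒞' C
    split : ∀ {C i₀ C₁ C₂} → IsCircuit C → SplitsInto C i₀ C₁ C₂ →
            ClΔ 𝒞' C₁ → ClΔ 𝒞' C₂ → ClΔ 𝒞' C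

  CircuitsUpTo : ℕ → Subset n → Set
  CircuitsUpTo k C = IsCircuit C × ∣ C ∣ ≤ k

  -- 𝒞 = cl_Δ(𝒞_k)   (the inclusion cl_Δ(𝒞_k) ⊆ 𝒞 holds by construction)
  GeneratedBy : ℕ → Set
  GeneratedBy k = ∀ C → IsCircuit C → ClΔ (CircuitsUpTo k) C

-- Splitting preserves closedness: if C splits into C₁ and C₂ at i, then every set
-- containing whatever C₁ and C₂ span from it also contains whatever C spans from it.
-- Hence, when all circuits are generated by those of size at most ℓ + 1, a set is
-- closed as soon as it contains the closures of its subsets of size at most ℓ; and a
-- circuit of size at least ℓ + 2, not being a generator, was obtained by splitting and
-- so has a chord. Conversely, in a simple matroid the two halves of a split are strictly
-- smaller, so chords generate every circuit by induction on size.
-- Finally, let C be a chordless circuit of size at least ℓ + 2 and e ∈ C. Then C - e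
-- contains the closure of each of its subsets Y with |Y| ≤ ℓ: a circuit D with
-- D - f ⊆ Y and f ∉ C would make f a chord of C (binarity makes C Δ D a circuit),
-- and f = e would force D = C, which is too large. But C spans e, so C - e is not closed.
module Submission where

open import Defs
open import Data.Bool using (true; false)
open import Data.Bool.Properties using () renaming (_≟_ to _≟ᵇ_)
open import Data.Empty using (⊥-elim)
open import Data.Fin using (Fin)
open import Data.Fin.Properties using (any?) renaming (_≟_ to _≟ᶠ_)
open import Data.Fin.Subset
  using (Subset; ⊥; ⁅_⁆; _∈_; _∉_; _⊆_; _∩_; _─_; _-_; ∣_∣; Nonempty; inside; outside)
open import Data.Fin.Subset.Properties
  using (_∈?_; ∉⊥; x∈⁅x⁆; x∈⁅y⁆⇒x≡y; x∉⁅y⁆⇒x≢y; ⊆-refl; ⊆-trans; ⊆-antisym;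
         p⊆q⇒∣p∣≤∣q∣; x∈p∩q⁺; x∈p∩q⁻; ∩-comm; p⊆p∪q; q⊆p∪q; ∪-comm; ∪-identityʳ;
         x∈p∪q⁻; x∈p∪q⁺; x∈p∧x∉q⇒x∈p─q; p─q⊆p; p─⊥≡p; x∈p∧x≢y⇒x∈p-y;
         x∈p⇒∣p-x∣<∣p∣; nonempty?; Empty-unique; anySubset?; ∣⊥∣≡0; ∣⁅x⁆∣≡1)
open import Data.List using ([]; _∷_)
open import Data.List.Relation.Unary.All using (_∷_)
open import Data.List.Relation.Unary.AllPairs using (_∷_)
open import Data.Nat using (ℕ; suc; _+_; _*_; _≤_; _<_; z≤n; s≤s; _≤?_)
open import Data.Nat.Induction using (<-wellFounded)
open import Data.Nat.Properties
  using (≤-trans; ≤-reflexive; ≤-pred; m≤n⇒m≤1+n; <⇒≱; ≰⇒>; +-suc; +-comm; +-monoʳ-≤; +-cancelʳ-≤;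
         module ≤-Reasoning)
open import Data.Nat.Tactic.RingSolver using (solve-∀)
open import Data.Product using (∃; _×_; _,_; proj₁)
open import Data.Sum using (_⊎_; inj₁; inj₂)
open import Data.Vec using ([]; _∷_; there)
open import Data.Vec.Properties using (≡-dec)
open import Function using (_∘_)
open import Function.Bundles using (_⇔_; mk⇔; Equivalence)
open import Induction.WellFounded using (Acc; acc)
open import Relation.Nullary using (¬_; Dec; yes; no)
open import Relation.Nullary.Decidable using (_×-dec_)
open import Relation.Binary.PropositionalEquality
  using (_≡_; _≢_; refl; sym; trans; cong; subst; module ≡-Reasoning)

private variable
  n : ℕ
  x y : Fin n

x∈p─q⇒x∉q : ∀ (p q : Subset n) → x ∈ p ─ q → x ∉ q
x∈p─q⇒x∉q {x = Fin.zero}  (_ ∷ _) (inside  ∷ _) ()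
x∈p─q⇒x∉q {x = Fin.zero}  (_ ∷ _) (outside ∷ _) _ ()
x∈p─q⇒x∉q {x = Fin.suc _} (_ ∷ p) (_ ∷ q) (there x∈p─q) (there x∈q) = x∈p─q⇒x∉q p q x∈p─q x∈q

x∈p-y⇒x≢y : ∀ (p : Subset n) → x ∈ p - y → x ≢ y
x∈p-y⇒x≢y {y = y} p = x∉⁅y⁆⇒x≢y ∘ x∈p─q⇒x∉q p ⁅ y ⁆

x∈pΔq⁻ : ∀ (p q : Subset n) → x ∈ p Δ q → (x ∈ p × x ∉ q) ⊎ (x ∈ q × x ∉ p)
x∈pΔq⁻ p q x∈pΔq with x∈p∪q⁻ (p ─ q) (q ─ p) x∈pΔq
... | inj₁ x∈p─q = inj₁ (p─q⊆p p q x∈p─q , x∈p─q⇒x∉q p q x∈p─q)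
... | inj₂ x∈q─p = inj₂ (p─q⊆p q p x∈q─p , x∈p─q⇒x∉q q p x∈q─p)

x∈p∧x∉q⇒x∈pΔq : ∀ {p q : Subset n} → x ∈ p → x ∉ q → x ∈ p Δ q
x∈p∧x∉q⇒x∈pΔq x∈p x∉q = x∈p∪q⁺ (inj₁ (x∈p∧x∉q⇒x∈p─q x∈p x∉q))

x∈q∧x∉p⇒x∈pΔq : ∀ {p q : Subset n} → x ∈ q → x ∉ p → x ∈ p Δ q
x∈q∧x∉p⇒x∈pΔq x∈q x∉p = x∈p∪q⁺ (inj₂ (x∈p∧x∉q⇒x∈p─q x∈q x∉p))

Δ-comm : ∀ (p q : Subset n) → p Δ q ≡ q Δ p
Δ-comm p q = ∪-comm (p ─ q) (q ─ p)

p≡qΔ[pΔq] : ∀ (p q : Subset n) → p ≡ q Δ (p Δ q)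
p≡qΔ[pΔq] []          []          = refl
p≡qΔ[pΔq] (true  ∷ p) (true  ∷ q) = cong (true  ∷_) (p≡qΔ[pΔq] p q)
p≡qΔ[pΔq] (true  ∷ p) (false ∷ q) = cong (true  ∷_) (p≡qΔ[pΔq] p q)
p≡qΔ[pΔq] (false ∷ p) (true  ∷ q) = cong (false ∷_) (p≡qΔ[pΔq] p q)
p≡qΔ[pΔq] (false ∷ p) (false ∷ q) = cong (false ∷_) (p≡qΔ[pΔq] p q)

∣p∣+∣q∣≡∣pΔq∣+2∣p∩q∣ : ∀ (p q : Subset n) → ∣ p ∣ + ∣ q ∣ ≡ ∣ p Δ q ∣ + 2 * ∣ p ∩ q ∣
∣p∣+∣q∣≡∣pΔq∣+2∣p∩q∣ []          []          = refl
∣p∣+∣q∣≡∣pΔq∣+2∣p∩q∣ (true  ∷ p) (true  ∷ q) = begin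
  suc (∣ p ∣ + suc ∣ q ∣)             ≡⟨ cong suc (+-suc ∣ p ∣ ∣ q ∣) ⟩
  2 + (∣ p ∣ + ∣ q ∣)                 ≡⟨ cong (2 +_) (∣p∣+∣q∣≡∣pΔq∣+2∣p∩q∣ p q) ⟩
  2 + (∣ p Δ q ∣ + 2 * ∣ p ∩ q ∣)     ≡⟨ regroup ∣ p Δ q ∣ ∣ p ∩ q ∣ ⟩
  ∣ p Δ q ∣ + 2 * suc ∣ p ∩ q ∣       ∎
  where
  open ≡-Reasoning
  regroup : ∀ d k → 2 + (d + 2 * k) ≡ d + 2 * suc k
  regroup = solve-∀
∣p∣+∣q∣≡∣pΔq∣+2∣p∩q∣ (true  ∷ p) (false ∷ q) = cong suc (∣p∣+∣q∣≡∣pΔq∣+2∣p∩q∣ p q)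
∣p∣+∣q∣≡∣pΔq∣+2∣p∩q∣ (false ∷ p) (true  ∷ q) =
  trans (+-suc ∣ p ∣ ∣ q ∣) (cong suc (∣p∣+∣q∣≡∣pΔq∣+2∣p∩q∣ p q))
∣p∣+∣q∣≡∣pΔq∣+2∣p∩q∣ (false ∷ p) (false ∷ q) = ∣p∣+∣q∣≡∣pΔq∣+2∣p∩q∣ p q

∣p∣≤1+∣p-x∣ : ∀ (p : Subset n) x → ∣ p ∣ ≤ suc ∣ p - x ∣
∣p∣≤1+∣p-x∣ (true  ∷ p) Fin.zero    = s≤s (≤-reflexive (cong ∣_∣ (sym (p─⊥≡p p))))
∣p∣≤1+∣p-x∣ (false ∷ p) Fin.zero    = m≤n⇒m≤1+n (≤-reflexive (cong ∣_∣ (sym (p─⊥≡p p))))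
∣p∣≤1+∣p-x∣ (true  ∷ p) (Fin.suc x) = s≤s (∣p∣≤1+∣p-x∣ p x)
∣p∣≤1+∣p-x∣ (false ∷ p) (Fin.suc x) = ∣p∣≤1+∣p-x∣ p x

p∩q≡⁅x⁆⇒x∈p : ∀ {p q : Subset n} → p ∩ q ≡ ⁅ x ⁆ → x ∈ p
p∩q≡⁅x⁆⇒x∈p {x = x} {p} {q} p∩q≡⁅x⁆ = proj₁ (x∈p∩q⁻ p q (subst (x ∈_) (sym p∩q≡⁅x⁆) (x∈⁅x⁆ x)))

p∩q≡⁅x⁆⇒x∈q : ∀ {p q : Subset n} → p ∩ q ≡ ⁅ x ⁆ → x ∈ q
p∩q≡⁅x⁆⇒x∈q {p = p} {q} p∩q≡⁅x⁆ = p∩q≡⁅x⁆⇒x∈p (trans (∩-comm q p) p∩q≡⁅x⁆)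

p∩q≡⁅x⁆∧y∈p∧y∈q⇒y≡x : ∀ {p q : Subset n} → p ∩ q ≡ ⁅ x ⁆ → y ∈ p → y ∈ q → y ≡ x
p∩q≡⁅x⁆∧y∈p∧y∈q⇒y≡x {x = x} p∩q≡⁅x⁆ y∈p y∈q =
  x∈⁅y⁆⇒x≡y x (subst (_ ∈_) p∩q≡⁅x⁆ (x∈p∩q⁺ (y∈p , y∈q)))

ℓ+2≤m⇒m≰ℓ+1 : ∀ {ℓ m} → ℓ + 2 ≤ m → ¬ m ≤ ℓ + 1
ℓ+2≤m⇒m≰ℓ+1 {ℓ} {m} ℓ+2≤m = <⇒≱ (subst (_≤ m) (+-suc ℓ 1) ℓ+2≤m)

module _ {n : ℕ} (M : Matroid n) where
  open Matroid M

  private variable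
    C C₁ C₂ D X : Subset n
    e f i : Fin n

  splits-sym : SplitsInto M C i C₁ C₂ → SplitsInto M C i C₂ C₁
  splits-sym {C₁ = C₁} {C₂} (c₁ , c₂ , C₁∩C₂≡⁅i⁆ , C≡C₁ΔC₂) =
    c₂ , c₁ , trans (∩-comm C₂ C₁) C₁∩C₂≡⁅i⁆ , trans C≡C₁ΔC₂ (Δ-comm C₁ C₂)

  split-size : SplitsInto M C i C₁ C₂ → ∣ C₁ ∣ + ∣ C₂ ∣ ≡ ∣ C ∣ + 2
  split-size {i = i} {C₁} {C₂} (_ , _ , C₁∩C₂≡⁅i⁆ , refl) = begin
    ∣ C₁ ∣ + ∣ C₂ ∣                ≡⟨ ∣p∣+∣q∣≡∣pΔq∣+2∣p∩q∣ C₁ C₂ ⟩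
    ∣ C₁ Δ C₂ ∣ + 2 * ∣ C₁ ∩ C₂ ∣  ≡⟨ cong (λ s → ∣ C₁ Δ C₂ ∣ + 2 * ∣ s ∣) C₁∩C₂≡⁅i⁆ ⟩
    ∣ C₁ Δ C₂ ∣ + 2 * ∣ ⁅ i ⁆ ∣    ≡⟨ cong (λ k → ∣ C₁ Δ C₂ ∣ + 2 * k) (∣⁅x⁆∣≡1 i) ⟩
    ∣ C₁ Δ C₂ ∣ + 2                ∎
    where open ≡-Reasoning

  split-smaller : Simple M → SplitsInto M C i C₁ C₂ → ∣ C₁ ∣ < ∣ C ∣
  split-smaller {C = C} {C₁ = C₁} {C₂} simple sp@(_ , c₂ , _) =
    +-cancelʳ-≤ 2 (suc ∣ C₁ ∣) ∣ C ∣ (begin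
      suc ∣ C₁ ∣ + 2   ≡⟨ +-suc ∣ C₁ ∣ 2 ⟨
      ∣ C₁ ∣ + 3       ≤⟨ +-monoʳ-≤ ∣ C₁ ∣ (simple C₂ c₂) ⟩
      ∣ C₁ ∣ + ∣ C₂ ∣  ≡⟨ split-size sp ⟩
      ∣ C ∣ + 2        ∎)
    where open ≤-Reasoning

  CircuitClosed : Subset n → Subset n → Set
  CircuitClosed C X = ∀ e → e ∈ C → C - e ⊆ X → e ∈ X

  circuitClosed⇒closed : (∀ {C} → IsCircuit C → CircuitClosed C X) → Closed M X
  circuitClosed⇒closed _      e (inj₁ e∈X)                   = e∈X
  circuitClosed⇒closed closed e (inj₂ (_ , c , e∈C , C-e⊆X)) = closed c e e∈C C-e⊆X

  -- The chord i is spanned by C₂ - i, which lies in C - e; then C₁ - e lies in X.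
  split-circuitClosedˡ : SplitsInto M C i C₁ C₂ → CircuitClosed C₁ X → CircuitClosed C₂ X →
                         e ∈ C₁ → e ∉ C₂ → C - e ⊆ X → e ∈ X
  split-circuitClosedˡ {i = i} {C₁} {C₂} {X} {e} (_ , _ , C₁∩C₂≡⁅i⁆ , refl)
    closed₁ closed₂ e∈C₁ e∉C₂ C-e⊆X = closed₁ e e∈C₁ C₁-e⊆X
    where
    only-i : ∀ {x} → x ∈ C₁ → x ∈ C₂ → x ≡ i
    only-i = p∩q≡⁅x⁆∧y∈p∧y∈q⇒y≡x C₁∩C₂≡⁅i⁆

    C₂-i⊆X : C₂ - i ⊆ X
    C₂-i⊆X {x} x∈C₂-i = C-e⊆X (x∈p∧x≢y⇒x∈p-y x∈C (λ { refl → e∉C₂ x∈C₂ }))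
      where
      x∈C₂ : x ∈ C₂
      x∈C₂ = p─q⊆p C₂ ⁅ i ⁆ x∈C₂-i
      x∈C : x ∈ C₁ Δ C₂
      x∈C = x∈q∧x∉p⇒x∈pΔq x∈C₂ (λ x∈C₁ → x∈p-y⇒x≢y C₂ x∈C₂-i (only-i x∈C₁ x∈C₂))

    C₁-e⊆X : C₁ - e ⊆ X
    C₁-e⊆X {x} x∈C₁-e with x ≟ᶠ i
    ... | yes refl = closed₂ i (p∩q≡⁅x⁆⇒x∈q C₁∩C₂≡⁅i⁆) C₂-i⊆X
    ... | no x≢i   = C-e⊆X (x∈p∧x≢y⇒x∈p-y (x∈p∧x∉q⇒x∈pΔq x∈C₁ (x≢i ∘ only-i x∈C₁))
                                           (x∈p-y⇒x≢y C₁ x∈C₁-e))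
      where
      x∈C₁ : x ∈ C₁
      x∈C₁ = p─q⊆p C₁ ⁅ e ⁆ x∈C₁-e

  split-circuitClosed : SplitsInto M C i C₁ C₂ → CircuitClosed C₁ X → CircuitClosed C₂ X →
                        CircuitClosed C X
  split-circuitClosed {C₁ = C₁} {C₂ = C₂} sp@(_ , _ , _ , C≡C₁ΔC₂) closed₁ closed₂ e e∈C
    with x∈pΔq⁻ C₁ C₂ (subst (e ∈_) C≡C₁ΔC₂ e∈C)
  ... | inj₁ (e∈C₁ , e∉C₂) = split-circuitClosedˡ sp closed₁ closed₂ e∈C₁ e∉C₂
  ... | inj₂ (e∈C₂ , e∉C₁) = split-circuitClosedˡ (splits-sym sp) closed₂ closed₁ e∈C₂ e∉C₁

  ClΔ-circuitClosed : ∀ {𝒞'} → (∀ {D} → 𝒞' D → CircuitClosed D X) → ClΔ M 𝒞' C → CircuitClosed C X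
  ClΔ-circuitClosed closed (base _ C∈𝒞')      = closed C∈𝒞'
  ClΔ-circuitClosed closed (split _ sp g₁ g₂) =
    split-circuitClosed sp (ClΔ-circuitClosed closed g₁) (ClΔ-circuitClosed closed g₂)

  circuit-nonempty : IsCircuit C → Nonempty C
  circuit-nonempty {C} c with nonempty? C
  ... | yes ne = ne
  ... | no ¬ne = ⊥-elim (empty-not (subst IsCircuit (Empty-unique ¬ne) c))

  punctured-circuit-nonempty : Simple M → IsCircuit C → Nonempty (C - f)
  punctured-circuit-nonempty {C} {f} simple c with nonempty? (C - f)
  ... | yes ne = ne
  ... | no ¬ne = ⊥-elim (<⇒≱ (s≤s (s≤s z≤n)) (begin
    3                ≤⟨ simple C c ⟩
    ∣ C ∣            ≤⟨ ∣p∣≤1+∣p-x∣ C f ⟩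
    suc ∣ C - f ∣    ≡⟨ cong (suc ∘ ∣_∣) (Empty-unique ¬ne) ⟩
    suc ∣ ⊥ {n} ∣    ≡⟨ cong suc (∣⊥∣≡0 n) ⟩
    1                ∎))
    where open ≤-Reasoning

  hasChord? : ∀ C → Dec (∃ (HasChordAt M C))
  hasChord? C = any? λ i → anySubset? λ C₁ → anySubset? λ C₂ →
    circuit? C₁ ×-dec circuit? C₂ ×-dec (C₁ ∩ C₂) ≟ ⁅ i ⁆ ×-dec C ≟ (C₁ Δ C₂)
    where
    infix 4 _≟_
    _≟_ : (p q : Subset n) → Dec (p ≡ q)
    _≟_ = ≡-dec _≟ᵇ_

  binary⇒Δ-circuit : Binary M → IsCircuit C → IsCircuit D → C ≢ D → e ∈ C Δ D →
                     (∀ {E} → IsCircuit E → E ⊆ C Δ D → e ∈ E) → IsCircuit (C Δ D)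
  binary⇒Δ-circuit {C} {D} {e} binary c d C≢D e∈CΔD e∈circuits with binary C D c d C≢D
  ... | [] , _ , _ , ⋃≡CΔD = ⊥-elim (∉⊥ (subst (e ∈_) (sym ⋃≡CΔD) e∈CΔD))
  ... | E ∷ [] , ε ∷ _ , _ , ⋃≡CΔD = subst IsCircuit (trans (sym (∪-identityʳ E)) ⋃≡CΔD) ε
  ... | E₁ ∷ E₂ ∷ _ , ε₁ ∷ ε₂ ∷ _ , (E₁∩E₂≡⊥ ∷ _) ∷ _ , ⋃≡CΔD =
    ⊥-elim (∉⊥ (subst (e ∈_) E₁∩E₂≡⊥ (x∈p∩q⁺ (e∈circuits ε₁ E₁⊆CΔD , e∈circuits ε₂ E₂⊆CΔD))))
    where
    E₁⊆CΔD : E₁ ⊆ C Δ D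
    E₁⊆CΔD x∈E₁ = subst (_ ∈_) ⋃≡CΔD (p⊆p∪q _ x∈E₁)
    E₂⊆CΔD : E₂ ⊆ C Δ D
    E₂⊆CΔD x∈E₂ = subst (_ ∈_) ⋃≡CΔD (q⊆p∪q E₁ _ (p⊆p∪q _ x∈E₂))

  -- f splits C into D and C Δ D. The latter is a circuit because a circuit E ⊆ C Δ D
  -- avoiding f would lie in C, hence equal C, which would force D ⊆ ⁅ f ⁆.
  chord-outside : Simple M → Binary M → IsCircuit C → IsCircuit D →
                  f ∈ D → f ∉ C → D - f ⊆ C → HasChordAt M C f
  chord-outside {C} {D} {f} simple binary c d f∈D f∉C D-f⊆C =
    D , C Δ D , d , binary⇒Δ-circuit binary c d C≢D f∈CΔD f∈circuits , D∩CΔD≡⁅f⁆ , p≡qΔ[pΔq] C D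
    where
    D∖f⊆C : ∀ {x} → x ∈ D → x ≢ f → x ∈ C
    D∖f⊆C x∈D x≢f = D-f⊆C (x∈p∧x≢y⇒x∈p-y x∈D x≢f)

    f∈CΔD : f ∈ C Δ D
    f∈CΔD = x∈q∧x∉p⇒x∈pΔq f∈D f∉C

    C≢D : C ≢ D
    C≢D refl = f∉C f∈D

    f∈circuits : ∀ {E} → IsCircuit E → E ⊆ C Δ D → f ∈ E
    f∈circuits {E} ε E⊆CΔD with f ∈? E
    ... | yes f∈E = f∈E
    ... | no f∉E with punctured-circuit-nonempty {f = f} simple d
    ...   | x , x∈D-f = ⊥-elim (x∉CΔD (E⊆CΔD (subst (x ∈_) C≡E (D-f⊆C x∈D-f))))
      where
      E⊆C : E ⊆ C
      E⊆C {y} y∈E with x∈pΔq⁻ C D (E⊆CΔD y∈E)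
      ... | inj₁ (y∈C , _) = y∈C
      ... | inj₂ (y∈D , _) = D∖f⊆C y∈D (λ { refl → f∉E y∈E })
      C≡E : C ≡ E
      C≡E = sym (incomparable ε c E⊆C)
      x∉CΔD : x ∉ C Δ D
      x∉CΔD x∈CΔD with x∈pΔq⁻ C D x∈CΔD
      ... | inj₁ (_ , x∉D) = x∉D (p─q⊆p D ⁅ f ⁆ x∈D-f)
      ... | inj₂ (_ , x∉C) = x∉C (D-f⊆C x∈D-f)

    D∩CΔD≡⁅f⁆ : D ∩ (C Δ D) ≡ ⁅ f ⁆
    D∩CΔD≡⁅f⁆ = ⊆-antisym D∩CΔD⊆⁅f⁆ ⁅f⁆⊆D∩CΔD
      where
      D∩CΔD⊆⁅f⁆ : D ∩ (C Δ D) ⊆ ⁅ f ⁆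
      D∩CΔD⊆⁅f⁆ {x} x∈D∩CΔD with x∈p∩q⁻ D (C Δ D) x∈D∩CΔD
      ... | x∈D , x∈CΔD with x∈pΔq⁻ C D x∈CΔD | x ≟ᶠ f
      ...   | inj₁ (_ , x∉D) | _        = ⊥-elim (x∉D x∈D)
      ...   | inj₂ _         | yes refl = x∈⁅x⁆ x
      ...   | inj₂ (_ , x∉C) | no x≢f   = ⊥-elim (x∉C (D∖f⊆C x∈D x≢f))
      ⁅f⁆⊆D∩CΔD : ⁅ f ⁆ ⊆ D ∩ (C Δ D)
      ⁅f⁆⊆D∩CΔD x∈⁅f⁆ rewrite x∈⁅y⁆⇒x≡y f x∈⁅f⁆ = x∈p∩q⁺ (f∈D , f∈CΔD)

  module _ (ℓ : ℕ) where

    SmallClosed : Subset n → Set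
    SmallClosed X = ∀ Y → Y ⊆ X → ∣ Y ∣ ≤ ℓ → ClSub M Y X

    closed⇒smallClosed : Closed M X → SmallClosed X
    closed⇒smallClosed _      Y Y⊆X _ e (inj₁ e∈Y)                   = Y⊆X e∈Y
    closed⇒smallClosed closed Y Y⊆X _ e (inj₂ (C , c , e∈C , C-e⊆Y)) =
      closed e (inj₂ (C , c , e∈C , ⊆-trans C-e⊆Y Y⊆X))

    smallClosed⇒circuitClosed : SmallClosed X → CircuitsUpTo M (ℓ + 1) C → CircuitClosed C X
    smallClosed⇒circuitClosed {C = C} smallClosed (c , ∣C∣≤ℓ+1) e e∈C C-e⊆X =
      smallClosed (C - e) C-e⊆X ∣C-e∣≤ℓ e (inj₂ (C , c , e∈C , ⊆-refl))
      where
      ∣C-e∣≤ℓ : ∣ C - e ∣ ≤ ℓ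
      ∣C-e∣≤ℓ = ≤-pred (≤-trans (x∈p⇒∣p-x∣<∣p∣ e∈C) (≤-trans ∣C∣≤ℓ+1 (≤-reflexive (+-comm ℓ 1))))

    generated⇒closedBy : GeneratedBy M (ℓ + 1) → IsClosedBy M ℓ
    generated⇒closedBy generated X = mk⇔ closed⇒smallClosed λ smallClosed →
      circuitClosed⇒closed λ c →
        ClΔ-circuitClosed (smallClosed⇒circuitClosed smallClosed) (generated _ c)

    generated⇒chordal : GeneratedBy M (ℓ + 1) → Chordal M (ℓ + 2)
    generated⇒chordal generated C c ℓ+2≤∣C∣ with generated C c
    ... | base _ (_ , ∣C∣≤ℓ+1) = ⊥-elim (ℓ+2≤m⇒m≰ℓ+1 ℓ+2≤∣C∣ ∣C∣≤ℓ+1)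
    ... | split {i₀ = i} _ sp _ _ = i , _ , _ , sp

    chordal⇒generated : Simple M → Chordal M (ℓ + 2) → GeneratedBy M (ℓ + 1)
    chordal⇒generated simple chordal C c = generate (<-wellFounded ∣ C ∣) c
      where
      generate : ∀ {C} → Acc _<_ ∣ C ∣ → IsCircuit C → ClΔ M (CircuitsUpTo M (ℓ + 1)) C
      generate {C} (acc smaller) c with ∣ C ∣ ≤? ℓ + 1
      ... | yes ∣C∣≤ℓ+1 = base c (c , ∣C∣≤ℓ+1)
      ... | no ∣C∣≰ℓ+1 with chordal C c (subst (_≤ ∣ C ∣) (sym (+-suc ℓ 1)) (≰⇒> ∣C∣≰ℓ+1))
      ...   | _ , _ , _ , sp@(c₁ , c₂ , _) =
        split c sp (generate (smaller (split-smaller simple sp)) c₁)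
                   (generate (smaller (split-smaller simple (splits-sym sp))) c₂)

    chordless-span : Simple M → Binary M → IsCircuit C → ℓ + 2 ≤ ∣ C ∣ → ¬ ∃ (HasChordAt M C) →
                     IsCircuit D → f ∈ D → D - f ⊆ C - e → ∣ D - f ∣ ≤ ℓ → f ∈ C - e
    chordless-span {C} {D} {f} {e} simple binary c ℓ+2≤∣C∣ chordless d f∈D D-f⊆C-e ∣D-f∣≤ℓ
      with f ∈? C
    ... | no f∉C = ⊥-elim (chordless (f , chord-outside simple binary c d f∈D f∉C D-f⊆C))
      where
      D-f⊆C : D - f ⊆ C
      D-f⊆C = ⊆-trans D-f⊆C-e (p─q⊆p C ⁅ e ⁆)
    ... | yes f∈C with f ≟ᶠ e
    ...   | no f≢e   = x∈p∧x≢y⇒x∈p-y f∈C f≢e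
    ...   | yes refl = ⊥-elim (ℓ+2≤m⇒m≰ℓ+1 ℓ+2≤∣C∣ ∣C∣≤ℓ+1)
      where
      D⊆C : D ⊆ C
      D⊆C {x} x∈D with x ≟ᶠ f
      ... | yes refl = f∈C
      ... | no x≢f   = p─q⊆p C ⁅ f ⁆ (D-f⊆C-e (x∈p∧x≢y⇒x∈p-y x∈D x≢f))
      ∣C∣≤ℓ+1 : ∣ C ∣ ≤ ℓ + 1
      ∣C∣≤ℓ+1 = begin
        ∣ C ∣          ≡⟨ cong ∣_∣ (incomparable d c D⊆C) ⟨
        ∣ D ∣          ≤⟨ ∣p∣≤1+∣p-x∣ D f ⟩
        suc ∣ D - f ∣  ≤⟨ s≤s ∣D-f∣≤ℓ ⟩
        suc ℓ          ≡⟨ +-comm 1 ℓ ⟩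
        ℓ + 1          ∎
        where open ≤-Reasoning

    closedBy⇒chordal : Simple M → Binary M → IsClosedBy M ℓ → Chordal M (ℓ + 2)
    closedBy⇒chordal simple binary closedBy C c ℓ+2≤∣C∣ with hasChord? C
    ... | yes chord     = chord
    ... | no chordless with circuit-nonempty c
    ...   | e , e∈C = ⊥-elim (x∈p-y⇒x≢y C (C-e-closed e (inj₂ (C , c , e∈C , ⊆-refl))) refl)
      where
      C-e-smallClosed : SmallClosed (C - e)
      C-e-smallClosed _ Y⊆C-e _ f (inj₁ f∈Y) = Y⊆C-e f∈Y
      C-e-smallClosed _ Y⊆C-e ∣Y∣≤ℓ f (inj₂ (D , d , f∈D , D-f⊆Y)) =
        chordless-span simple binary c ℓ+2≤∣C∣ chordless d f∈D
          (⊆-trans D-f⊆Y Y⊆C-e) (≤-trans (p⊆q⇒∣p∣≤∣q∣ D-f⊆Y) ∣Y∣≤ℓ)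
      C-e-closed : Closed M (C - e)
      C-e-closed = Equivalence.from (closedBy (C - e)) C-e-smallClosed

theorem2p6 : ∀ {n : ℕ} (M : Matroid n) (ℓ : ℕ) → 2 ≤ ℓ →
    Simple M → Binary M →
    (IsClosedBy M ℓ ⇔ Chordal M (ℓ + 2)) × (Chordal M (ℓ + 2) ⇔ GeneratedBy M (ℓ + 1))
theorem2p6 M ℓ _ simple binary =
  mk⇔ (closedBy⇒chordal M ℓ simple binary) (generated⇒closedBy M ℓ ∘ chordal⇒generated M ℓ simple) ,
  mk⇔ (chordal⇒generated M ℓ simple) (generated⇒chordal M ℓ)
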